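{- For any untyped $\lambda$-term $M$, the following are equivalent: (1) $\Gamma\vdash_\omega M:A$ for some typing context $\Gamma$ and type $A$, both $\omega$-free; (2) $\Gamma\vdash_{s\omega} M:A$ for some $\Gamma$ and $A$, both $\omega$-free; (3) $\Gamma\vdash_{\ell\omega} M:A$ for some $\Gamma$ and $A$, both $\omega$-free; (4) $\Gamma\vdash_{\ell} M:A$ for some typing context $\Gamma$ and type $A$; (5) $M$ is weakly $\beta$-normalising (some $\beta$-reduction sequence from $M$ reaches a $\beta$-normal form).
   Context: $\lambda$-terms: $M::=x\mid MM\mid \lambda x.M$ modulo $\alpha$-conversion; $M[x:=N]$ is capture-avoiding substitution; $\to_\beta$ is the contextual closure of $(\lambda x.M)N\to M[x:=N]$. Types: $A::=\varphi\mid A\to A\mid A\cap A$ ($\varphi$ type variables), extended by a constant $\omega$ in the $\omega$-systems; a type or context is $\omega$-free if $\omega$ does not occur in it. A typing context is a finite set of pairs $x:A$; $\Gamma,x:A$ denotes $\Gamma\cup\{x:A\}$; $x\notin\Gamma$ means no $x:B$ lies in $\Gamma$. In natural-deduction systems variables of a context are pairwise distinct; in the sequent-style systems a variable may occur with several types. $\Lambda_\cap$ rules: (Ax) $\Gamma,x:A\vdash x:A$; ($\to$I) from $\Gamma,x:A\vdash M:B$, $x\notin\Gamma$, infer $\Gamma\vdash\lambda x.M:A\to B$; ($\to$E) from $\Gamma\vdash M:A\to B$ and $\Gamma\vdash N:A$ infer $\Gamma\vdash MN:B$; ($\cap$I) from $\Gamma\vdash M:A$, $\Gamma\vdash M:B$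 infer $\Gamma\vdash M:A\cap B$; ($\cap$E) from $\Gamma\vdash M:A\cap B$ infer $\Gamma\vdash M:A$ and $\Gamma\vdash M:B$. $\Lambda_\cap^s$ rules ($n\ge0$): (Ax) $\Gamma,x:A\vdash x:A$; $(\mathsf{Beta})^s$ from $\Gamma\vdash M[x:=N]N_1\dots N_n:A$ and $\Gamma\vdash N:B$ infer $\Gamma\vdash(\lambda x.M)NN_1\dots N_n:A$; $(\mathsf{L}\to)$ from $\Gamma\vdash N:A_1$ and $\Gamma,y:A_2\vdash yN_1\dots N_n:B$, with $y\notin FV(N_1)\cup\dots\cup FV(N_n)$, $y\notin\Gamma$, infer $\Gamma,x:A_1\to A_2\vdash xNN_1\dots N_n:B$; $(\mathsf{R}\to)$ from $\Gamma,x:A\vdash M:B$, $x\notin\Gamma$, infer $\Gamma\vdash\lambda x.M:A\to B$; $(\mathsf{L}\cap)$ from $\Gamma,x:A_1,x:A_2\vdash xN_1\dots N_n:B$ infer $\Gamma,x:A_1\cap A_2\vdash xN_1\dots N_n:B$; $(\mathsf{R}\cap)$ from $\Gamma\vdash M:A$, $\Gamma\vdash M:B$ infer $\Gamma\vdash M:A\cap B$. $\Lambda_\cap^\ell$ (judgement $\vdash_\ell$): $\Lambda_\cap^s$ with $(\mathsf{Beta})^s$ replaced by $(\mathsf{Beta})^\ell$: from $\Gamma\vdash M[x:=N]N_1\dots N_n:A$ infer $\Gamma\vdash(\lambda x.M)NN_1\dots N_n:A$. The systems $\Lambda_{\cap\omega}$, $\Lambda_{\cap\omega}^s$, $\Lambda_{\cap\omega}^\ell$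 (judgements $\vdash_\omega$, $\vdash_{s\omega}$, $\vdash_{\ell\omega}$) are $\Lambda_\cap$, $\Lambda_\cap^s$, $\Lambda_\cap^\ell$ extended with the type constant $\omega$ and the axiom $(\omega)$: $\Gamma\vdash M:\omega$ for every $\Gamma$, $M$. -}

module Defs where

open import Data.Bool using (Bool; true; false)
open import Data.Nat using (ℕ; zero; suc)
open import Data.Product using (Σ; ∃; _×_; _,_)
open import Data.List using (List; []; _∷_; map)
open import Data.List.Relation.Unary.All using (All)
open import Data.List.Membership.Propositional using (_∈_)
open import Data.List.Relation.Binary.BagAndSetEquality using (_∼[_]_; set)
open import Relation.Binary.PropositionalEquality using (_≡_)
open import Relation.Binary.Construct.Closure.ReflexiveTransitive using (Star)
open import Relation.Nullary using (¬_)

-- Untyped λ-terms modulo α-conversion: de Bruijn indices.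
-- Free variables are the natural numbers; `lam M` binds index 0.

data Term : Set where
  var : ℕ → Term
  app : Term → Term → Term
  lam : Term → Term

apps : Term → List Term → Term
apps M []       = M
apps M (N ∷ Ns) = apps (app M N) Ns

ext : (ℕ → ℕ) → ℕ → ℕ
ext ρ zero    = zero
ext ρ (suc n) = suc (ρ n)

rename : (ℕ → ℕ) → Term → Term
rename ρ (var x)   = var (ρ x)
rename ρ (app M N) = app (rename ρ M) (rename ρ N)
rename ρ (lam M)   = lam (rename (ext ρ) M)

exts : (ℕ → Term) → ℕ → Term
exts σ zero    = var zero
exts σ (suc n) = rename suc (σ n)

subst : (ℕ → Term) → Term → Term
subst σ (var x)   = σ x
subst σ (app M N) = app (subst σ M) (subst σ N)
subst σ (lam M)   = lam (subst (exts σ) M)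

-- M[0 := N] for the body M of a λ (the remaining indices are lowered)
sub0 : Term → ℕ → Term
sub0 N zero    = N
sub0 N (suc n) = var n

_[_] : Term → Term → Term
M [ N ] = subst (sub0 N) M

data _∈FV_ : ℕ → Term → Set where
  fv-var  : ∀ {x} → x ∈FV var x
  fv-appˡ : ∀ {x M N} → x ∈FV M → x ∈FV app M N
  fv-appʳ : ∀ {x M N} → x ∈FV N → x ∈FV app M N
  fv-lam  : ∀ {x M} → suc x ∈FV M → x ∈FV lam M

data _→β_ : Term → Term → Set where
  β    : ∀ {M N} → app (lam M) N →β (M [ N ])
  appˡ : ∀ {M M' N} → M →β M' → app M N →β app M' N
  appʳ : ∀ {M N N'} → N →β N' → app M N →β app M N'
  ξlam : ∀ {M M'} → M →β M' → lam M →β lam M'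

_→β*_ : Term → Term → Set
_→β*_ = Star _→β_

NormalForm : Term → Set
NormalForm N = ∀ N' → ¬ (N →β N')

WeaklyNormalising : Term → Set
WeaklyNormalising M = ∃ λ N → (M →β* N) × NormalForm N

-- Intersection types.  `Ty false`: types A ::= φ | A → A | A ∩ A;
-- `Ty true`: the same extended with the constant ω.

data Ty : Bool → Set where
  tvar : ∀ {b} → ℕ → Ty b
  _⇒_  : ∀ {b} → Ty b → Ty b → Ty b
  _∩_  : ∀ {b} → Ty b → Ty b → Ty b
  ω    : Ty true

infixr 7 _⇒_
infixr 8 _∩_

data ωFree : Ty true → Set where
  tvar : ∀ {φ} → ωFree (tvar φ)
  _⇒_  : ∀ {A B} → ωFree A → ωFree B → ωFree (A ⇒ B)
  _∩_  : ∀ {A B} → ωFree A → ωFree B → ωFree (A ∩ B)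

-- Typing contexts: finite sets of pairs x : A, represented by lists
-- (only membership matters; Γ , x : A is x : A ∷ Γ).
Ctx : Bool → Set
Ctx b = List (ℕ × Ty b)

ωFreeCtx : Ctx true → Set
ωFreeCtx Γ = All (λ { (x , A) → ωFree A }) Γ

_≈ctx_ : ∀ {b} → Ctx b → Ctx b → Set
Γ ≈ctx Δ = Γ ∼[ set ] Δ

_∉ctx_ : ∀ {b} → ℕ → Ctx b → Set
x ∉ctx Γ = ∀ B → ¬ ((x , B) ∈ Γ)

Functional : Ctx true → Set
Functional Γ = ∀ {x A B} → (x , A) ∈ Γ → (x , B) ∈ Γ → A ≡ B

-- going under a binder: the bound variable is index 0, so "x ∉ Γ" holds
-- automatically for the shifted context.
shiftCtx : ∀ {b} → Ctx b → Ctx b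
shiftCtx = map (λ { (x , A) → (suc x , A) })

data _⊢ω_∶_ (Γ : Ctx true) : Term → Ty true → Set where
  Ax  : ∀ {x A} → (x , A) ∈ Γ → Γ ⊢ω var x ∶ A
  →I  : ∀ {M A B} → ((zero , A) ∷ shiftCtx Γ) ⊢ω M ∶ B → Γ ⊢ω lam M ∶ (A ⇒ B)
  →E  : ∀ {M N A B} → Γ ⊢ω M ∶ (A ⇒ B) → Γ ⊢ω N ∶ A → Γ ⊢ω app M N ∶ B
  ∩I  : ∀ {M A B} → Γ ⊢ω M ∶ A → Γ ⊢ω M ∶ B → Γ ⊢ω M ∶ (A ∩ B)
  ∩E₁ : ∀ {M A B} → Γ ⊢ω M ∶ (A ∩ B) → Γ ⊢ω M ∶ A
  ∩E₂ : ∀ {M A B} → Γ ⊢ω M ∶ (A ∩ B) → Γ ⊢ω M ∶ B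
  ωAx : ∀ {M} → Γ ⊢ω M ∶ ω

-- Sequent-style systems, parametrised by the (Beta) rule variant and by
-- whether ω is present (b = true: the ω-system, with axiom (ω)).

data BetaKind : Set where
  s ℓ : BetaKind

data Seq (k : BetaKind) : {b : Bool} → Ctx b → Term → Ty b → Set where
  Ax     : ∀ {b} {Γ : Ctx b} {x A} → (x , A) ∈ Γ → Seq k Γ (var x) A
  Beta-s : ∀ {b} {Γ : Ctx b} {M N Ns A B} → k ≡ s →
           Seq k Γ (apps (M [ N ]) Ns) A → Seq k Γ N B →
           Seq k Γ (apps (app (lam M) N) Ns) A
  Beta-ℓ : ∀ {b} {Γ : Ctx b} {M N Ns A} → k ≡ ℓ →
           Seq k Γ (apps (M [ N ]) Ns) A →
           Seq k Γ (apps (app (lam M) N) Ns) A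
  L→     : ∀ {b} {Δ Γ : Ctx b} {x y N Ns A₁ A₂ B} →
           Δ ≈ctx ((x , A₁ ⇒ A₂) ∷ Γ) →
           All (λ Nᵢ → ¬ (y ∈FV Nᵢ)) Ns → y ∉ctx Γ →
           Seq k Γ N A₁ → Seq k ((y , A₂) ∷ Γ) (apps (var y) Ns) B →
           Seq k Δ (apps (var x) (N ∷ Ns)) B
  R→     : ∀ {b} {Γ : Ctx b} {M A B} → Seq k ((zero , A) ∷ shiftCtx Γ) M B →
           Seq k Γ (lam M) (A ⇒ B)
  L∩     : ∀ {b} {Δ Γ : Ctx b} {x Ns A₁ A₂ B} →
           Δ ≈ctx ((x , A₁ ∩ A₂) ∷ Γ) →
           Seq k ((x , A₁) ∷ (x , A₂) ∷ Γ) (apps (var x) Ns) B →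
           Seq k Δ (apps (var x) Ns) B
  R∩     : ∀ {b} {Γ : Ctx b} {M A B} → Seq k Γ M A → Seq k Γ M B → Seq k Γ M (A ∩ B)
  ωAx    : ∀ {Γ : Ctx true} {M} → Seq k Γ M ω

_⊢s_∶_ : Ctx false → Term → Ty false → Set
_⊢s_∶_ = Seq s
_⊢ℓ_∶_ : Ctx false → Term → Ty false → Set
_⊢ℓ_∶_ = Seq ℓ
_⊢sω_∶_ : Ctx true → Term → Ty true → Set
_⊢sω_∶_ = Seq s
_⊢ℓω_∶_ : Ctx true → Term → Ty true → Set
_⊢ℓω_∶_ = Seq ℓ

-- Weak normalisation is captured inductively by WN: normal forms built from
-- WN pieces, closed under head expansion.  A β-normal form is typable
-- without ω, and natural-deduction typing is closed under β-expansion, so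
-- every weakly normalising term has an ω-free Λ∩ω typing; conversely a
-- reducibility argument turns an ω-free Λ∩ω typing into a WN derivation.
-- The sequent systems are syntax-directed, so an ω-free derivation in either
-- of them is read off directly as a WN derivation ((Beta) is a head
-- expansion, (L→) builds a neutral term), and a WN derivation is turned into
-- a Λ∩ℓ derivation by giving each head variable the arrow type its spine
-- asks for.  Λ∩ℓ embeds into Λ∩ℓω, and Λ∩ℓω into Λ∩sω by giving the
-- discarded argument of (Beta) the type ω.
module Submission where

open import Defs
open import Data.Bool using (true; false)
open import Data.Empty using (⊥; ⊥-elim)
open import Data.List using (List; []; _∷_; map; _++_; upTo)
open import Data.List.Membership.Propositional using (_∈_)
open import Data.List.Membership.Propositional.Properties using (∈-map⁺; ∈-map⁻; ∈-upTo⁺)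
open import Data.List.Relation.Binary.Subset.Propositional using (_⊆_)
open import Data.List.Relation.Unary.All as All using (All; []; _∷_)
open import Data.List.Relation.Unary.All.Properties using (++⁺; map⁺)
open import Data.List.Relation.Unary.Any using (Any; here; there)
open import Data.Nat using (ℕ; zero; suc; _<_; _≤_; _⊔_; _≟_)
open import Data.Nat.Properties using (m≤m⊔n; m≤n⊔m; <-≤-trans; ≤-trans; <-trans; n<1+n; suc-injective; ≤⇒≯)
open import Data.Product using (∃; _×_; _,_; proj₁; proj₂)
open import Data.Sum using (_⊎_; inj₁; inj₂)
open import Data.Unit using (⊤; tt)
open import Function using (_∘_)
open import Function.Bundles using (_⇔_; mk⇔; Equivalence)
open import Relation.Binary.Construct.Closure.ReflexiveTransitive using (ε; _◅_; _◅◅_; gmap)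
open import Relation.Binary.PropositionalEquality using (_≡_; refl; sym; trans; cong; cong₂) renaming (subst to substEq)
open import Relation.Nullary using (¬_; yes; no)

ext-cong : ∀ {ρ ρ' : ℕ → ℕ} → (∀ x → ρ x ≡ ρ' x) → ∀ x → ext ρ x ≡ ext ρ' x
ext-cong e zero    = refl
ext-cong e (suc x) = cong suc (e x)

rename-cong : ∀ {ρ ρ' : ℕ → ℕ} → (∀ x → ρ x ≡ ρ' x) → ∀ M → rename ρ M ≡ rename ρ' M
rename-cong e (var x)   = cong var (e x)
rename-cong e (app M N) = cong₂ app (rename-cong e M) (rename-cong e N)
rename-cong e (lam M)   = cong lam (rename-cong (ext-cong e) M)

exts-cong : ∀ {σ σ' : ℕ → Term} → (∀ x → σ x ≡ σ' x) → ∀ x → exts σ x ≡ exts σ' x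
exts-cong e zero    = refl
exts-cong e (suc x) = cong (rename suc) (e x)

subst-cong : ∀ {σ σ' : ℕ → Term} → (∀ x → σ x ≡ σ' x) → ∀ M → subst σ M ≡ subst σ' M
subst-cong e (var x)   = e x
subst-cong e (app M N) = cong₂ app (subst-cong e M) (subst-cong e N)
subst-cong e (lam M)   = cong lam (subst-cong (exts-cong e) M)

rename-rename : ∀ ρ ρ' M → rename ρ (rename ρ' M) ≡ rename (ρ ∘ ρ') M
rename-rename ρ ρ' (var x)   = refl
rename-rename ρ ρ' (app M N) = cong₂ app (rename-rename ρ ρ' M) (rename-rename ρ ρ' N)
rename-rename ρ ρ' (lam M)   = cong lam (trans (rename-rename (ext ρ) (ext ρ') M) (rename-cong ext-∘ M))
  where ext-∘ : ∀ x → ext ρ (ext ρ' x) ≡ ext (ρ ∘ ρ') x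
        ext-∘ zero    = refl
        ext-∘ (suc x) = refl

subst-rename : ∀ σ ρ M → subst σ (rename ρ M) ≡ subst (σ ∘ ρ) M
subst-rename σ ρ (var x)   = refl
subst-rename σ ρ (app M N) = cong₂ app (subst-rename σ ρ M) (subst-rename σ ρ N)
subst-rename σ ρ (lam M)   = cong lam (trans (subst-rename (exts σ) (ext ρ) M) (subst-cong exts-ext M))
  where exts-ext : ∀ x → exts σ (ext ρ x) ≡ exts (σ ∘ ρ) x
        exts-ext zero    = refl
        exts-ext (suc x) = refl

rename-subst : ∀ ρ σ M → rename ρ (subst σ M) ≡ subst (rename ρ ∘ σ) M
rename-subst ρ σ (var x)   = refl
rename-subst ρ σ (app M N) = cong₂ app (rename-subst ρ σ M) (rename-subst ρ σ N)
rename-subst ρ σ (lam M)   = cong lam (trans (rename-subst (ext ρ) (exts σ) M) (subst-cong ext-exts M))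
  where ext-exts : ∀ x → rename (ext ρ) (exts σ x) ≡ exts (rename ρ ∘ σ) x
        ext-exts zero    = refl
        ext-exts (suc x) = trans (rename-rename (ext ρ) suc (σ x)) (sym (rename-rename suc ρ (σ x)))

subst-subst : ∀ τ σ M → subst τ (subst σ M) ≡ subst (subst τ ∘ σ) M
subst-subst τ σ (var x)   = refl
subst-subst τ σ (app M N) = cong₂ app (subst-subst τ σ M) (subst-subst τ σ N)
subst-subst τ σ (lam M)   = cong lam (trans (subst-subst (exts τ) (exts σ) M) (subst-cong exts-exts M))
  where exts-exts : ∀ x → subst (exts τ) (exts σ x) ≡ exts (subst τ ∘ σ) x
        exts-exts zero    = refl
        exts-exts (suc x) = trans (subst-rename (exts τ) suc (σ x)) (sym (rename-subst suc τ (σ x)))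

subst-var : ∀ M → subst var M ≡ M
subst-var (var x)   = refl
subst-var (app M N) = cong₂ app (subst-var M) (subst-var N)
subst-var (lam M)   = cong lam (trans (subst-cong exts-var M) (subst-var M))
  where exts-var : ∀ x → exts var x ≡ var x
        exts-var zero    = refl
        exts-var (suc x) = refl

rename≡subst : ∀ ρ M → rename ρ M ≡ subst (var ∘ ρ) M
rename≡subst ρ (var x)   = refl
rename≡subst ρ (app M N) = cong₂ app (rename≡subst ρ M) (rename≡subst ρ N)
rename≡subst ρ (lam M)   = cong lam (trans (rename≡subst (ext ρ) M) (subst-cong ext-var M))
  where ext-var : ∀ x → var (ext ρ x) ≡ exts (var ∘ ρ) x
        ext-var zero    = refl
        ext-var (suc x) = refl

_•_ : Term → (ℕ → Term) → ℕ → Term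
(N • σ) zero    = N
(N • σ) (suc x) = σ x

subst-exts-[] : ∀ σ N M → subst (exts σ) M [ N ] ≡ subst (N • σ) M
subst-exts-[] σ N M = trans (subst-subst (sub0 N) (exts σ) M) (subst-cong sub0-exts M)
  where sub0-exts : ∀ x → subst (sub0 N) (exts σ x) ≡ (N • σ) x
        sub0-exts zero    = refl
        sub0-exts (suc x) = trans (subst-rename (sub0 N) suc (σ x)) (subst-var (σ x))

rename-[] : ∀ ρ M N → rename (ext ρ) M [ rename ρ N ] ≡ rename ρ (M [ N ])
rename-[] ρ M N =
  trans (subst-rename (sub0 (rename ρ N)) (ext ρ) M)
        (trans (subst-cong sub0-ext M) (sym (rename-subst ρ (sub0 N) M)))
  where sub0-ext : ∀ x → sub0 (rename ρ N) (ext ρ x) ≡ rename ρ (sub0 N x)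
        sub0-ext zero    = refl
        sub0-ext (suc x) = refl

apps-∷ʳ : ∀ M Ns N → apps M (Ns ++ N ∷ []) ≡ app (apps M Ns) N
apps-∷ʳ M []       N = refl
apps-∷ʳ M (N' ∷ Ns) N = apps-∷ʳ (app M N') Ns N

-- Inductive weak normalisation

infix 4 _⟶ₕ_

data _⟶ₕ_ : Term → Term → Set where
  β    : ∀ {M N} → app (lam M) N ⟶ₕ M [ N ]
  appˡ : ∀ {M M' N} → M ⟶ₕ M' → app M N ⟶ₕ app M' N

mutual
  data WNe : Term → Set where
    var : ∀ {x} → WNe (var x)
    app : ∀ {M N} → WNe M → WN N → WNe (app M N)

  data WN : Term → Set where
    ne  : ∀ {M} → WNe M → WN M
    lam : ∀ {M} → WN M → WN (lam M)
    exp : ∀ {M M'} → M ⟶ₕ M' → WN M' → WN M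

mutual
  data Ne : Term → Set where
    var : ∀ {x} → Ne (var x)
    app : ∀ {M N} → Ne M → Nf N → Ne (app M N)

  data Nf : Term → Set where
    ne  : ∀ {M} → Ne M → Nf M
    lam : ∀ {M} → Nf M → Nf (lam M)

⟶ₕ⇒→β : ∀ {M M'} → M ⟶ₕ M' → M →β M'
⟶ₕ⇒→β β        = β
⟶ₕ⇒→β (appˡ h) = appˡ (⟶ₕ⇒→β h)

⟶ₕ-apps : ∀ {M M'} → M ⟶ₕ M' → ∀ Ns → apps M Ns ⟶ₕ apps M' Ns
⟶ₕ-apps h []       = h
⟶ₕ-apps h (N ∷ Ns) = ⟶ₕ-apps (appˡ h) Ns

⟶ₕ-inv : ∀ {M M'} → M ⟶ₕ M' →
         ∃ λ P → ∃ λ Q → ∃ λ Ns → M ≡ apps (app (lam P) Q) Ns × M' ≡ apps (P [ Q ]) Ns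
⟶ₕ-inv (β {P} {Q}) = P , Q , [] , refl , refl
⟶ₕ-inv (appˡ {N = N} h) with ⟶ₕ-inv h
... | P , Q , Ns , refl , refl = P , Q , Ns ++ N ∷ [] , sym (apps-∷ʳ _ Ns N) , sym (apps-∷ʳ _ Ns N)

mutual
  Ne⇒normal : ∀ {M} → Ne M → NormalForm M
  Ne⇒normal var         _ ()
  Ne⇒normal (app () n)  _ β
  Ne⇒normal (app m n)   _ (appˡ st) = Ne⇒normal m _ st
  Ne⇒normal (app m n)   _ (appʳ st) = Nf⇒normal n _ st

  Nf⇒normal : ∀ {M} → Nf M → NormalForm M
  Nf⇒normal (ne m)  = Ne⇒normal m
  Nf⇒normal (lam n) _ (ξlam st) = Nf⇒normal n _ st

mutual
  normal⇒Nf : ∀ M → NormalForm M → Nf M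
  normal⇒Nf (var x)   _ = ne var
  normal⇒Nf (lam M)   h = lam (normal⇒Nf M (λ _ st → h _ (ξlam st)))
  normal⇒Nf (app M N) h = ne (normal⇒Ne-app M N h)

  normal⇒Ne-app : ∀ M N → NormalForm (app M N) → Ne (app M N)
  normal⇒Ne-app (var x)    N h = app var (normal⇒Nf N (λ _ st → h _ (appʳ st)))
  normal⇒Ne-app (app M M') N h =
    app (normal⇒Ne-app M M' (λ _ st → h _ (appˡ st))) (normal⇒Nf N (λ _ st → h _ (appʳ st)))
  normal⇒Ne-app (lam M)    N h = ⊥-elim (h _ β)

mutual
  WNe⇒↠Ne : ∀ {M} → WNe M → ∃ λ N → (M →β* N) × Ne N
  WNe⇒↠Ne var = _ , ε , var
  WNe⇒↠Ne {app M N} (app m n) with WNe⇒↠Ne m | WN⇒↠Nf n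
  ... | M' , M↠M' , m' | N' , N↠N' , n' =
    app M' N' , (gmap (λ P → app P N) appˡ M↠M' ◅◅ gmap (app M') appʳ N↠N') , app m' n'

  WN⇒↠Nf : ∀ {M} → WN M → ∃ λ N → (M →β* N) × Nf N
  WN⇒↠Nf (ne m) with WNe⇒↠Ne m
  ... | N , M↠N , m' = N , M↠N , ne m'
  WN⇒↠Nf (lam n) with WN⇒↠Nf n
  ... | N , M↠N , n' = lam N , gmap lam ξlam M↠N , lam n'
  WN⇒↠Nf (exp h n) with WN⇒↠Nf n
  ... | N , M'↠N , n' = N , ⟶ₕ⇒→β h ◅ M'↠N , n'

WN⇒weaklyNormalising : ∀ {M} → WN M → WeaklyNormalising M
WN⇒weaklyNormalising w with WN⇒↠Nf w
... | N , M↠N , n = N , M↠N , Nf⇒normal n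

fvBound : Term → ℕ
fvBound (var x)   = suc x
fvBound (app M N) = fvBound M ⊔ fvBound N
fvBound (lam M)   = fvBound M

∈FV⇒<fvBound : ∀ {x} M → x ∈FV M → x < fvBound M
∈FV⇒<fvBound (var x)   fv-var      = n<1+n x
∈FV⇒<fvBound (app M N) (fv-appˡ p) = <-≤-trans (∈FV⇒<fvBound M p) (m≤m⊔n _ _)
∈FV⇒<fvBound (app M N) (fv-appʳ p) = <-≤-trans (∈FV⇒<fvBound N p) (m≤n⊔m _ _)
∈FV⇒<fvBound (lam M)   (fv-lam p)  = <-trans (n<1+n _) (∈FV⇒<fvBound M p)

∈FV-rename⁻ : ∀ {z} ρ M → z ∈FV rename ρ M → ∃ λ w → w ∈FV M × z ≡ ρ w
∈FV-rename⁻ ρ (var x) fv-var = x , fv-var , refl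
∈FV-rename⁻ ρ (app M N) (fv-appˡ p) with ∈FV-rename⁻ ρ M p
... | w , q , e = w , fv-appˡ q , e
∈FV-rename⁻ ρ (app M N) (fv-appʳ p) with ∈FV-rename⁻ ρ N p
... | w , q , e = w , fv-appʳ q , e
∈FV-rename⁻ ρ (lam M) (fv-lam p) with ∈FV-rename⁻ (ext ρ) M p
... | zero  , q , ()
... | suc w , q , e = w , fv-lam q , suc-injective e

∈FV-subst⁻ : ∀ {z} σ M → z ∈FV subst σ M → ∃ λ y → y ∈FV M × z ∈FV σ y
∈FV-subst⁻ σ (var x) p = x , fv-var , p
∈FV-subst⁻ σ (app M N) (fv-appˡ p) with ∈FV-subst⁻ σ M p
... | y , q , r = y , fv-appˡ q , r
∈FV-subst⁻ σ (app M N) (fv-appʳ p) with ∈FV-subst⁻ σ N p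
... | y , q , r = y , fv-appʳ q , r
∈FV-subst⁻ σ (lam M) (fv-lam p) with ∈FV-subst⁻ (exts σ) M p
... | zero  , q , ()
... | suc y , q , r with ∈FV-rename⁻ suc (σ y) r
...   | w , r' , e = y , fv-lam q , substEq (_∈FV σ y) (sym (suc-injective e)) r'

∈FV-[]⁻ : ∀ {z} M N → z ∈FV (M [ N ]) → z ∈FV app (lam M) N
∈FV-[]⁻ M N p with ∈FV-subst⁻ (sub0 N) M p
... | zero  , q , r      = fv-appʳ r
... | suc y , q , fv-var = fv-appˡ (fv-lam q)

∈FV-apps-head : ∀ {z M} Ns → z ∈FV M → z ∈FV apps M Ns
∈FV-apps-head []       p = p
∈FV-apps-head (N ∷ Ns) p = ∈FV-apps-head Ns (fv-appˡ p)

∈FV-apps-arg : ∀ {z} M Ns → Any (z ∈FV_) Ns → z ∈FV apps M Ns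
∈FV-apps-arg M (N ∷ Ns) (here p)  = ∈FV-apps-head Ns (fv-appʳ p)
∈FV-apps-arg M (N ∷ Ns) (there q) = ∈FV-apps-arg (app M N) Ns q

∈FV-apps⁻ : ∀ {z} M Ns → z ∈FV apps M Ns → z ∈FV M ⊎ Any (z ∈FV_) Ns
∈FV-apps⁻ M []       p = inj₁ p
∈FV-apps⁻ M (N ∷ Ns) p with ∈FV-apps⁻ (app M N) Ns p
... | inj₁ (fv-appˡ q) = inj₁ q
... | inj₁ (fv-appʳ q) = inj₂ (here q)
... | inj₂ a           = inj₂ (there a)

∈FV-[]-apps⁻ : ∀ {z} M N Ns → z ∈FV apps (M [ N ]) Ns → z ∈FV apps (app (lam M) N) Ns
∈FV-[]-apps⁻ M N Ns p with ∈FV-apps⁻ (M [ N ]) Ns p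
... | inj₁ q = ∈FV-apps-head Ns (∈FV-[]⁻ M N q)
... | inj₂ a = ∈FV-apps-arg _ Ns a

-- A total environment stands for the context listing the free variables of
-- the term; going under a binder is then just consing.
Env : Set
Env = ℕ → Ty true

_∷ₑ_ : Ty true → Env → Env
(A ∷ₑ E) zero    = A
(A ∷ₑ E) (suc x) = E x

_∩ₑ_ : Env → Env → Env
(E ∩ₑ F) x = E x ∩ F x

single : ℕ → Ty true → Ty true → Env
single x A D y with y ≟ x
... | yes _ = A
... | no _  = D

single-≡ : ∀ x A D → single x A D x ≡ A
single-≡ x A D with x ≟ x
... | yes _ = refl
... | no x≢x = ⊥-elim (x≢x refl)

data _⊩_∶_ (E : Env) : Term → Ty true → Set where
  ax   : ∀ {x} → E ⊩ var x ∶ E x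
  lamI : ∀ {M A B} → (A ∷ₑ E) ⊩ M ∶ B → E ⊩ lam M ∶ (A ⇒ B)
  appE : ∀ {M N A B} → E ⊩ M ∶ (A ⇒ B) → E ⊩ N ∶ A → E ⊩ app M N ∶ B
  ∩I   : ∀ {M A B} → E ⊩ M ∶ A → E ⊩ M ∶ B → E ⊩ M ∶ (A ∩ B)
  ∩E₁  : ∀ {M A B} → E ⊩ M ∶ (A ∩ B) → E ⊩ M ∶ A
  ∩E₂  : ∀ {M A B} → E ⊩ M ∶ (A ∩ B) → E ⊩ M ∶ B
  ωI   : ∀ {M} → E ⊩ M ∶ ω

⊩-var-transport : ∀ {E F y x A} → E ⊩ var y ∶ A → E y ≡ F x → F ⊩ var x ∶ A
⊩-var-transport {F = F} {x = x} ax e = substEq (λ A → F ⊩ var x ∶ A) (sym e) ax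
⊩-var-transport (∩I d d') e = ∩I (⊩-var-transport d e) (⊩-var-transport d' e)
⊩-var-transport (∩E₁ d)   e = ∩E₁ (⊩-var-transport d e)
⊩-var-transport (∩E₂ d)   e = ∩E₂ (⊩-var-transport d e)
⊩-var-transport ωI        e = ωI

⊩-rename : ∀ {E F ρ M A} → (∀ x → E x ≡ F (ρ x)) → E ⊩ M ∶ A → F ⊩ rename ρ M ∶ A
⊩-rename {E} e (ax {y}) = ⊩-var-transport {E = E} ax (e y)
⊩-rename {E} {F} {ρ} e (lamI {A = C} d) = lamI (⊩-rename e' d)
  where e' : ∀ x → (C ∷ₑ E) x ≡ (C ∷ₑ F) (ext ρ x)
        e' zero    = refl
        e' (suc x) = e x
⊩-rename e (appE d d') = appE (⊩-rename e d) (⊩-rename e d')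
⊩-rename e (∩I d d')   = ∩I (⊩-rename e d) (⊩-rename e d')
⊩-rename e (∩E₁ d)     = ∩E₁ (⊩-rename e d)
⊩-rename e (∩E₂ d)     = ∩E₂ (⊩-rename e d)
⊩-rename e ωI          = ωI

⊩-weaken : ∀ {E M A B} → E ⊩ M ∶ A → (B ∷ₑ E) ⊩ rename suc M ∶ A
⊩-weaken = ⊩-rename (λ _ → refl)

⊩-rename⁻ : ∀ {E F ρ A} M → (∀ x → F (ρ x) ≡ E x) → F ⊩ rename ρ M ∶ A → E ⊩ M ∶ A
⊩-rename⁻ (var x) e d = ⊩-var-transport d (e x)
⊩-rename⁻ M e (∩I d d') = ∩I (⊩-rename⁻ M e d) (⊩-rename⁻ M e d')
⊩-rename⁻ M e (∩E₁ d)   = ∩E₁ (⊩-rename⁻ M e d)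
⊩-rename⁻ M e (∩E₂ d)   = ∩E₂ (⊩-rename⁻ M e d)
⊩-rename⁻ M e ωI        = ωI
⊩-rename⁻ (app M N) e (appE d d') = appE (⊩-rename⁻ M e d) (⊩-rename⁻ N e d')
⊩-rename⁻ {E} {F} {ρ} (lam M) e (lamI {A = C} d) = lamI (⊩-rename⁻ M e' d)
  where e' : ∀ x → (C ∷ₑ F) (ext ρ x) ≡ (C ∷ₑ E) x
        e' zero    = refl
        e' (suc x) = e x

⊩-subst : ∀ {E F σ M A} → (∀ x → F ⊩ σ x ∶ E x) → E ⊩ M ∶ A → F ⊩ subst σ M ∶ A
⊩-subst ⊩σ (ax {x}) = ⊩σ x
⊩-subst {E} {F} {σ} ⊩σ (lamI {A = C} d) = lamI (⊩-subst ⊩σ' d)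
  where ⊩σ' : ∀ x → (C ∷ₑ F) ⊩ exts σ x ∶ (C ∷ₑ E) x
        ⊩σ' zero    = ax
        ⊩σ' (suc x) = ⊩-weaken (⊩σ x)
⊩-subst ⊩σ (appE d d') = appE (⊩-subst ⊩σ d) (⊩-subst ⊩σ d')
⊩-subst ⊩σ (∩I d d')   = ∩I (⊩-subst ⊩σ d) (⊩-subst ⊩σ d')
⊩-subst ⊩σ (∩E₁ d)     = ∩E₁ (⊩-subst ⊩σ d)
⊩-subst ⊩σ (∩E₂ d)     = ∩E₂ (⊩-subst ⊩σ d)
⊩-subst ⊩σ ωI          = ωI

⊩-refine : ∀ {E F M A} → (∀ x → F ⊩ var x ∶ E x) → E ⊩ M ∶ A → F ⊩ M ∶ A
⊩-refine {F = F} {M} {A} ⊩var d = substEq (λ P → F ⊩ P ∶ A) (subst-var M) (⊩-subst ⊩var d)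

⊩-∩ₑˡ : ∀ {E F M A} → E ⊩ M ∶ A → (E ∩ₑ F) ⊩ M ∶ A
⊩-∩ₑˡ = ⊩-refine (λ _ → ∩E₁ ax)

⊩-∩ₑʳ : ∀ {E F M A} → F ⊩ M ∶ A → (E ∩ₑ F) ⊩ M ∶ A
⊩-∩ₑʳ = ⊩-refine (λ _ → ∩E₂ ax)

SubstTyping : Env → (ℕ → Term) → Term → Ty true → Set
SubstTyping E σ M A = ∃ λ F → (F ⊩ M ∶ A) × (∀ x → E ⊩ σ x ∶ F x)

⊩-subst⁻ : ∀ {E A} σ M → E ⊩ subst σ M ∶ A → SubstTyping E σ M A
⊩-subst⁻ {E} {A} σ (var x) d =
  single x A ω , substEq (single x A ω ⊩ var x ∶_) (single-≡ x A ω) ax , σ-typing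
  where σ-typing : ∀ y → E ⊩ σ y ∶ single x A ω y
        σ-typing y with y ≟ x
        ... | yes refl = d
        ... | no _     = ωI
⊩-subst⁻ σ M (∩I d d') with ⊩-subst⁻ σ M d | ⊩-subst⁻ σ M d'
... | F₁ , m₁ , ⊩σ₁ | F₂ , m₂ , ⊩σ₂ = F₁ ∩ₑ F₂ , ∩I (⊩-∩ₑˡ m₁) (⊩-∩ₑʳ m₂) , λ y → ∩I (⊩σ₁ y) (⊩σ₂ y)
⊩-subst⁻ σ M (∩E₁ d) with ⊩-subst⁻ σ M d
... | F , m , ⊩σ = F , ∩E₁ m , ⊩σ
⊩-subst⁻ σ M (∩E₂ d) with ⊩-subst⁻ σ M d
... | F , m , ⊩σ = F , ∩E₂ m , ⊩σ
⊩-subst⁻ σ M ωI = (λ _ → ω) , ωI , λ _ → ωI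
⊩-subst⁻ σ (app M N) (appE d d') with ⊩-subst⁻ σ M d | ⊩-subst⁻ σ N d'
... | F₁ , m₁ , ⊩σ₁ | F₂ , m₂ , ⊩σ₂ = F₁ ∩ₑ F₂ , appE (⊩-∩ₑˡ m₁) (⊩-∩ₑʳ m₂) , λ y → ∩I (⊩σ₁ y) (⊩σ₂ y)
⊩-subst⁻ σ (lam M) (lamI {A = C} d) with ⊩-subst⁻ (exts σ) M d
... | F , m , ⊩σ = F ∘ suc , lamI (⊩-refine bound-var m) , λ y → ⊩-rename⁻ (σ y) (λ _ → refl) (⊩σ (suc y))
  where bound-var : ∀ y → (C ∷ₑ (F ∘ suc)) ⊩ var y ∶ F y
        bound-var zero    = ⊩-var-transport (⊩σ zero) refl
        bound-var (suc y) = ax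

⊩-expand : ∀ {E M M' A} → M →β M' → E ⊩ M' ∶ A → E ⊩ M ∶ A
⊩-expand {E} (β {M} {N}) d with ⊩-subst⁻ (sub0 N) M d
... | F , m , ⊩σ = appE (lamI (⊩-refine bound-var m)) (⊩σ zero)
  where bound-var : ∀ y → (F zero ∷ₑ E) ⊩ var y ∶ F y
        bound-var zero    = ax
        bound-var (suc y) = ⊩-weaken (⊩σ (suc y))
⊩-expand (appˡ st) (appE d d') = appE (⊩-expand st d) d'
⊩-expand (appʳ st) (appE d d') = appE d (⊩-expand st d')
⊩-expand (ξlam st) (lamI d)    = lamI (⊩-expand st d)
⊩-expand st (∩I d d') = ∩I (⊩-expand st d) (⊩-expand st d')
⊩-expand st (∩E₁ d)   = ∩E₁ (⊩-expand st d)
⊩-expand st (∩E₂ d)   = ∩E₂ (⊩-expand st d)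
⊩-expand st ωI        = ωI

⊩-expand* : ∀ {E M M' A} → M →β* M' → E ⊩ M' ∶ A → E ⊩ M ∶ A
⊩-expand* ε         d = d
⊩-expand* (st ◅ r) d = ⊩-expand st (⊩-expand* r d)

ωFreeEnv : Env → Set
ωFreeEnv E = ∀ x → ωFree (E x)

mutual
  Ne-typable : ∀ {M} → Ne M → ∀ B → ωFree B → ∃ λ E → ωFreeEnv E × E ⊩ M ∶ B
  Ne-typable (var {x}) B B-free =
    single x B (tvar 0) , single-free , substEq (single x B (tvar 0) ⊩ var x ∶_) (single-≡ x B (tvar 0)) ax
    where single-free : ωFreeEnv (single x B (tvar 0))
          single-free y with y ≟ x
          ... | yes _ = B-free
          ... | no _  = tvar
  Ne-typable (app m n) B B-free with Nf-typable n
  ... | E₂ , E₂-free , A , A-free , d₂ with Ne-typable m (A ⇒ B) (A-free ⇒ B-free)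
  ... | E₁ , E₁-free , d₁ =
    E₁ ∩ₑ E₂ , (λ y → E₁-free y ∩ E₂-free y) , appE (⊩-∩ₑˡ d₁) (⊩-∩ₑʳ d₂)

  Nf-typable : ∀ {M} → Nf M → ∃ λ E → ωFreeEnv E × ∃ λ A → ωFree A × E ⊩ M ∶ A
  Nf-typable (ne m) with Ne-typable m (tvar 0) tvar
  ... | E , E-free , d = E , E-free , tvar 0 , tvar , d
  Nf-typable (lam n) with Nf-typable n
  ... | E , E-free , A , A-free , d =
    E ∘ suc , E-free ∘ suc , E zero ⇒ A , E-free zero ⇒ A-free , lamI (⊩-refine η-env d)
    where η-env : ∀ y → (E zero ∷ₑ (E ∘ suc)) ⊩ var y ∶ E y
          η-env zero    = ax
          η-env (suc y) = ax

⊩⇒⊢ω : ∀ {E M A} → E ⊩ M ∶ A → (Γ : Ctx true) →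
       (∀ {x} → x ∈FV M → (x , E x) ∈ Γ) → (∀ {x B} → (x , B) ∈ Γ → B ≡ E x) → Γ ⊢ω M ∶ A
⊩⇒⊢ω ax Γ complete sound = Ax (complete fv-var)
⊩⇒⊢ω {E} (lamI {A = C} d) Γ complete sound =
  →I (⊩⇒⊢ω d ((zero , C) ∷ shiftCtx Γ) complete' sound')
  where complete' : ∀ {x} → x ∈FV _ → (x , (C ∷ₑ E) x) ∈ ((zero , C) ∷ shiftCtx Γ)
        complete' {zero}  p = here refl
        complete' {suc x} p = there (∈-map⁺ _ (complete (fv-lam p)))
        sound' : ∀ {x B} → (x , B) ∈ ((zero , C) ∷ shiftCtx Γ) → B ≡ (C ∷ₑ E) x
        sound' (here refl) = refl
        sound' (there p) with ∈-map⁻ _ p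
        ... | _ , q , refl = sound q
⊩⇒⊢ω (appE d d') Γ complete sound =
  →E (⊩⇒⊢ω d Γ (complete ∘ fv-appˡ) sound) (⊩⇒⊢ω d' Γ (complete ∘ fv-appʳ) sound)
⊩⇒⊢ω (∩I d d') Γ complete sound = ∩I (⊩⇒⊢ω d Γ complete sound) (⊩⇒⊢ω d' Γ complete sound)
⊩⇒⊢ω (∩E₁ d)   Γ complete sound = ∩E₁ (⊩⇒⊢ω d Γ complete sound)
⊩⇒⊢ω (∩E₂ d)   Γ complete sound = ∩E₂ (⊩⇒⊢ω d Γ complete sound)
⊩⇒⊢ω ωI        Γ complete sound = ωAx

envCtx : Env → ℕ → Ctx true
envCtx E n = map (λ x → x , E x) (upTo n)

envCtx-sound : ∀ {E n x B} → (x , B) ∈ envCtx E n → B ≡ E x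
envCtx-sound p with ∈-map⁻ _ p
... | _ , _ , refl = refl

weaklyNormalising⇒⊢ω : ∀ {M} → WeaklyNormalising M →
  ∃ λ (Γ : Ctx true) → ∃ λ A → Functional Γ × ωFreeCtx Γ × ωFree A × Γ ⊢ω M ∶ A
weaklyNormalising⇒⊢ω {M} (N , M↠N , N-normal) with Nf-typable (normal⇒Nf N N-normal)
... | E , E-free , A , A-free , d =
  Γ , A , (λ p q → trans (envCtx-sound p) (sym (envCtx-sound q))) ,
  All.tabulate (λ { {x , B} p → substEq ωFree (sym (envCtx-sound p)) (E-free x) }) , A-free ,
  ⊩⇒⊢ω (⊩-expand* M↠N d) Γ (λ p → ∈-map⁺ _ (∈-upTo⁺ (∈FV⇒<fvBound M p))) envCtx-sound
  where Γ = envCtx E (fvBound M)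

-- Reducibility: ω-free Λ∩ω typings yield WN

⟶ₕ-rename⁻ : ∀ {Q Q'} → Q ⟶ₕ Q' → ∀ ρ P → Q ≡ rename ρ P → ∃ λ P' → P ⟶ₕ P' × Q' ≡ rename ρ P'
⟶ₕ-rename⁻ β        ρ (app (lam P₁) P₂) refl = P₁ [ P₂ ] , β , rename-[] ρ P₁ P₂
⟶ₕ-rename⁻ (appˡ h) ρ (app P₁ P₂)       refl with ⟶ₕ-rename⁻ h ρ P₁ refl
... | P' , h' , e = app P' P₂ , appˡ h' , cong (λ R → app R (rename ρ P₂)) e

mutual
  WNe-rename⁻ : ∀ {Q} → WNe Q → ∀ ρ P → Q ≡ rename ρ P → WNe P
  WNe-rename⁻ var       ρ (var y)     refl = var
  WNe-rename⁻ (app m n) ρ (app P₁ P₂) refl = app (WNe-rename⁻ m ρ P₁ refl) (WN-rename⁻ n ρ P₂ refl)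

  WN-rename⁻ : ∀ {Q} → WN Q → ∀ ρ P → Q ≡ rename ρ P → WN P
  WN-rename⁻ (ne m)    ρ P       e    = ne (WNe-rename⁻ m ρ P e)
  WN-rename⁻ (lam n)   ρ (lam P) refl = lam (WN-rename⁻ n (ext ρ) P refl)
  WN-rename⁻ (exp h n) ρ P       e with ⟶ₕ-rename⁻ h ρ P e
  ... | P' , h' , e' = exp h' (WN-rename⁻ n ρ P' e')

-- If the head redex is contracted, (λ P) x ⟶ₕ P [ x ] is only a renaming of P.
WN-app-var⁻ : ∀ {M x} → WN (app M (var x)) → WN M
WN-app-var⁻ (ne (app m _)) = ne m
WN-app-var⁻ {x = x} (exp (β {P}) w) = lam (WN-rename⁻ w ρ P P[x]≡renameP)
  where ρ : ℕ → ℕ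
        ρ zero    = x
        ρ (suc n) = n
        sub0≡ρ : ∀ y → sub0 (var x) y ≡ var (ρ y)
        sub0≡ρ zero    = refl
        sub0≡ρ (suc y) = refl
        P[x]≡renameP : P [ var x ] ≡ rename ρ P
        P[x]≡renameP = trans (subst-cong sub0≡ρ P) (sym (rename≡subst ρ P))
WN-app-var⁻ (exp (appˡ h) w) = exp h (WN-app-var⁻ w)

⟦_⟧ : Ty true → Term → Set
⟦ tvar _ ⟧ M = WN M
⟦ A ⇒ B ⟧  M = ∀ N → ⟦ A ⟧ N → ⟦ B ⟧ (app M N)
⟦ A ∩ B ⟧  M = ⟦ A ⟧ M × ⟦ B ⟧ M
⟦ ω ⟧      M = ⊤

⟦⟧-expand : ∀ A {M M'} → M ⟶ₕ M' → ⟦ A ⟧ M' → ⟦ A ⟧ M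
⟦⟧-expand (tvar _) h r        = exp h r
⟦⟧-expand (A ⇒ B)  h r        = λ N n → ⟦⟧-expand B (appˡ h) (r N n)
⟦⟧-expand (A ∩ B)  h (r , r') = ⟦⟧-expand A h r , ⟦⟧-expand B h r'
⟦⟧-expand ω        h r        = tt

mutual
  ⟦⟧⇒WN : ∀ {A} → ωFree A → ∀ {M} → ⟦ A ⟧ M → WN M
  ⟦⟧⇒WN tvar          r       = r
  ⟦⟧⇒WN (A-free ⇒ B-free) r   = WN-app-var⁻ (⟦⟧⇒WN B-free (r (var 0) (WNe⇒⟦⟧ A-free var)))
  ⟦⟧⇒WN (A-free ∩ _)  (r , _) = ⟦⟧⇒WN A-free r

  WNe⇒⟦⟧ : ∀ {A} → ωFree A → ∀ {M} → WNe M → ⟦ A ⟧ M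
  WNe⇒⟦⟧ tvar              m = ne m
  WNe⇒⟦⟧ (A-free ⇒ B-free) m = λ N n → WNe⇒⟦⟧ B-free (app m (⟦⟧⇒WN A-free n))
  WNe⇒⟦⟧ (A-free ∩ B-free) m = WNe⇒⟦⟧ A-free m , WNe⇒⟦⟧ B-free m

⊢ω-sound : ∀ {Γ M A} → Γ ⊢ω M ∶ A → (σ : ℕ → Term) →
           (∀ {x B} → (x , B) ∈ Γ → ⟦ B ⟧ (σ x)) → ⟦ A ⟧ (subst σ M)
⊢ω-sound (Ax p) σ ⟦σ⟧ = ⟦σ⟧ p
⊢ω-sound {Γ} (→I {M} {A} {B} d) σ ⟦σ⟧ =
  λ N n → ⟦⟧-expand B β (substEq ⟦ B ⟧ (sym (subst-exts-[] σ N M)) (⊢ω-sound d (N • σ) (⟦N•σ⟧ n)))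
  where ⟦N•σ⟧ : ∀ {N} → ⟦ A ⟧ N → ∀ {x C} → (x , C) ∈ ((zero , A) ∷ shiftCtx Γ) → ⟦ C ⟧ ((N • σ) x)
        ⟦N•σ⟧ n (here refl) = n
        ⟦N•σ⟧ n (there p) with ∈-map⁻ _ p
        ... | _ , q , refl = ⟦σ⟧ q
⊢ω-sound (→E d e) σ ⟦σ⟧ = ⊢ω-sound d σ ⟦σ⟧ _ (⊢ω-sound e σ ⟦σ⟧)
⊢ω-sound (∩I d e) σ ⟦σ⟧ = ⊢ω-sound d σ ⟦σ⟧ , ⊢ω-sound e σ ⟦σ⟧
⊢ω-sound (∩E₁ d)  σ ⟦σ⟧ = proj₁ (⊢ω-sound d σ ⟦σ⟧)
⊢ω-sound (∩E₂ d)  σ ⟦σ⟧ = proj₂ (⊢ω-sound d σ ⟦σ⟧)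
⊢ω-sound ωAx      σ ⟦σ⟧ = tt

⊢ω⇒WN : ∀ {Γ M A} → ωFreeCtx Γ → ωFree A → Γ ⊢ω M ∶ A → WN M
⊢ω⇒WN {M = M} {A} Γ-free A-free d =
  ⟦⟧⇒WN A-free (substEq ⟦ A ⟧ (subst-var M) (⊢ω-sound d var (λ p → WNe⇒⟦⟧ (All.lookup Γ-free p) var)))

weaklyNormalising⇒WN : ∀ {M} → WeaklyNormalising M → WN M
weaklyNormalising⇒WN wn with weaklyNormalising⇒⊢ω wn
... | _ , _ , _ , Γ-free , A-free , d = ⊢ω⇒WN Γ-free A-free d

-- ω-free sequent derivations yield WN

data VarHead : Term → Set where
  var : ∀ {x} → VarHead (var x)
  app : ∀ {M N} → VarHead M → VarHead (app M N)

VarHead-apps : ∀ {M} → VarHead M → ∀ Ns → VarHead (apps M Ns)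
VarHead-apps v []       = v
VarHead-apps v (N ∷ Ns) = VarHead-apps (app v) Ns

VarHead-¬⟶ₕ : ∀ {M M'} → VarHead M → ¬ (M ⟶ₕ M')
VarHead-¬⟶ₕ (app ()) β
VarHead-¬⟶ₕ (app v)  (appˡ h) = VarHead-¬⟶ₕ v h

VarHead-WN⇒WNe : ∀ {M} → VarHead M → WN M → WNe M
VarHead-WN⇒WNe v  (ne m)    = m
VarHead-WN⇒WNe () (lam n)
VarHead-WN⇒WNe v  (exp h n) = ⊥-elim (VarHead-¬⟶ₕ v h)

WNe-apps : ∀ {M} → WNe M → ∀ {Ns} → All WN Ns → WNe (apps M Ns)
WNe-apps m []       = m
WNe-apps m (n ∷ ns) = WNe-apps (app m n) ns

WNe-apps⁻ : ∀ M Ns → WNe (apps M Ns) → WNe M × All WN Ns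
WNe-apps⁻ M []       m = m , []
WNe-apps⁻ M (N ∷ Ns) m with WNe-apps⁻ (app M N) Ns m
... | app m' n , ns = m' , n ∷ ns

WN-var-apps⁻ : ∀ {x} Ns → WN (apps (var x) Ns) → All WN Ns
WN-var-apps⁻ Ns w = proj₂ (WNe-apps⁻ _ Ns (VarHead-WN⇒WNe (VarHead-apps var Ns) w))

ωFreeCtx-≈∷ : ∀ {Δ Γ x A} → Δ ≈ctx ((x , A) ∷ Γ) → ωFreeCtx Δ → ωFree A × ωFreeCtx Γ
ωFreeCtx-≈∷ Δ≈ Δ-free =
  All.lookup Δ-free (Equivalence.from Δ≈ (here refl)) ,
  All.tabulate (λ p → All.lookup Δ-free (Equivalence.from Δ≈ (there p)))

Seq⇒WN : ∀ {k} {Γ : Ctx true} {M A} → Seq k Γ M A → ωFreeCtx Γ → ωFree A → WN M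
Seq⇒WN (Ax _)                   Γ-free A-free = ne var
Seq⇒WN (Beta-s {Ns = Ns} _ d _) Γ-free A-free = exp (⟶ₕ-apps β Ns) (Seq⇒WN d Γ-free A-free)
Seq⇒WN (Beta-ℓ {Ns = Ns} _ d)   Γ-free A-free = exp (⟶ₕ-apps β Ns) (Seq⇒WN d Γ-free A-free)
Seq⇒WN (L→ {Ns = Ns} Δ≈ _ _ d₁ d₂) Δ-free B-free with ωFreeCtx-≈∷ Δ≈ Δ-free
... | A₁-free ⇒ A₂-free , Γ-free =
  ne (WNe-apps (app var (Seq⇒WN d₁ Γ-free A₁-free)) (WN-var-apps⁻ Ns (Seq⇒WN d₂ (A₂-free ∷ Γ-free) B-free)))
Seq⇒WN (R→ d) Γ-free (A-free ⇒ B-free) = lam (Seq⇒WN d (A-free ∷ map⁺ Γ-free) B-free)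
Seq⇒WN (L∩ Δ≈ d) Δ-free B-free with ωFreeCtx-≈∷ Δ≈ Δ-free
... | A₁-free ∩ A₂-free , Γ-free = Seq⇒WN d (A₁-free ∷ A₂-free ∷ Γ-free) B-free
Seq⇒WN (R∩ d _) Γ-free (A-free ∩ _) = Seq⇒WN d Γ-free A-free
Seq⇒WN ωAx      Γ-free ()

-- WN terms are typable in Λ∩ℓ

-- x : A follows from Δ by projections out of intersections; (L∩) steps turn
-- it into an actual assumption (Proj-L∩).
data Proj (Δ : Ctx false) (x : ℕ) : Ty false → Set where
  elem : ∀ {A} → (x , A) ∈ Δ → Proj Δ x A
  ∩₁   : ∀ {A B} → Proj Δ x (A ∩ B) → Proj Δ x A
  ∩₂   : ∀ {A B} → Proj Δ x (A ∩ B) → Proj Δ x B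

Proj-mono : ∀ {Δ Δ' x A} → Δ ⊆ Δ' → Proj Δ x A → Proj Δ' x A
Proj-mono Δ⊆Δ' (elem p) = elem (Δ⊆Δ' p)
Proj-mono Δ⊆Δ' (∩₁ p)   = ∩₁ (Proj-mono Δ⊆Δ' p)
Proj-mono Δ⊆Δ' (∩₂ p)   = ∩₂ (Proj-mono Δ⊆Δ' p)

Proj-shift : ∀ {Δ x A} → Proj Δ x A → Proj (shiftCtx Δ) (suc x) A
Proj-shift (elem p) = elem (∈-map⁺ _ p)
Proj-shift (∩₁ p)   = ∩₁ (Proj-shift p)
Proj-shift (∩₂ p)   = ∩₂ (Proj-shift p)

∈⇒≈ctx-∷ : ∀ {b} {Δ : Ctx b} {p} → p ∈ Δ → Δ ≈ctx (p ∷ Δ)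
∈⇒≈ctx-∷ p∈Δ = mk⇔ there (λ { (here refl) → p∈Δ ; (there q) → q })

Proj-L∩ : ∀ {Δ x A Ns C} → Proj Δ x A →
          (∀ Δ' → Δ ⊆ Δ' → (x , A) ∈ Δ' → Δ' ⊢ℓ apps (var x) Ns ∶ C) → Δ ⊢ℓ apps (var x) Ns ∶ C
Proj-L∩ (elem p) k = k _ (λ q → q) p
Proj-L∩ {x = x} {Ns = Ns} (∩₁ {A} {B} p) k =
  Proj-L∩ {Ns = Ns} p λ Δ' Δ⊆Δ' q →
    L∩ {Ns = Ns} (∈⇒≈ctx-∷ q) (k ((x , A) ∷ (x , B) ∷ Δ') (there ∘ there ∘ Δ⊆Δ') (here refl))
Proj-L∩ {x = x} {Ns = Ns} (∩₂ {A} {B} p) k =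
  Proj-L∩ {Ns = Ns} p λ Δ' Δ⊆Δ' q →
    L∩ {Ns = Ns} (∈⇒≈ctx-∷ q) (k ((x , A) ∷ (x , B) ∷ Δ') (there ∘ there ∘ Δ⊆Δ') (there (here refl)))

-- Quantifying over all contexts that provide R x for the free variables
-- leaves room for the fresh variables that (L→) introduces.
UniformlyTypable : Term → Set
UniformlyTypable M =
  ∃ λ (R : ℕ → Ty false) → ∃ λ A → ∀ Δ → (∀ {x} → x ∈FV M → Proj Δ x (R x)) → Δ ⊢ℓ M ∶ A

spineType : ∀ Ns → All UniformlyTypable Ns → Ty false → Ty false
spineType []       []                  B = B
spineType (N ∷ Ns) ((R , A , _) ∷ ts) B = A ⇒ spineType Ns ts B

spineRequirement : ∀ Ns → All UniformlyTypable Ns → ℕ → Ty false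
spineRequirement []       []                  z = tvar 0
spineRequirement (N ∷ Ns) ((R , A , _) ∷ ts) z = R z ∩ spineRequirement Ns ts z

ctxBound : Ctx false → ℕ
ctxBound []            = 0
ctxBound ((x , _) ∷ Γ) = suc x ⊔ ctxBound Γ

∈⇒<ctxBound : ∀ {x A} Γ → (x , A) ∈ Γ → x < ctxBound Γ
∈⇒<ctxBound ((x , _) ∷ Γ) (here refl) = <-≤-trans (n<1+n x) (m≤m⊔n (suc x) (ctxBound Γ))
∈⇒<ctxBound ((x , _) ∷ Γ) (there p)   = <-≤-trans (∈⇒<ctxBound Γ p) (m≤n⊔m (suc x) (ctxBound Γ))

fvBounds : List Term → ℕ
fvBounds []       = 0
fvBounds (N ∷ Ns) = fvBound N ⊔ fvBounds Ns

fvBounds≤⇒∉FV : ∀ {y} Ns → fvBounds Ns ≤ y → All (λ N → ¬ (y ∈FV N)) Ns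
fvBounds≤⇒∉FV []       _ = []
fvBounds≤⇒∉FV (N ∷ Ns) le =
  (λ p → ≤⇒≯ (≤-trans (m≤m⊔n _ _) le) (∈FV⇒<fvBound N p)) ∷ fvBounds≤⇒∉FV Ns (≤-trans (m≤n⊔m _ _) le)

⊢ℓ-spine : ∀ {Δ x B} Ns ts → (x , spineType Ns ts B) ∈ Δ →
           (∀ {z} → Any (z ∈FV_) Ns → Proj Δ z (spineRequirement Ns ts z)) → Δ ⊢ℓ apps (var x) Ns ∶ B
⊢ℓ-spine [] [] p _ = Ax p
⊢ℓ-spine {Δ} {x} (N ∷ Ns) ((R , A , ⊢N) ∷ ts) p req =
  L→ {x = x} {y = y} {N = N} {Ns = Ns} (∈⇒≈ctx-∷ p) (fvBounds≤⇒∉FV Ns (m≤n⊔m _ _))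
     (λ _ q → ≤⇒≯ (m≤m⊔n _ _) (∈⇒<ctxBound Δ q))
     (⊢N Δ (∩₁ ∘ req ∘ here))
     (⊢ℓ-spine Ns ts (here refl) (Proj-mono there ∘ ∩₂ ∘ req ∘ there))
  where y = ctxBound Δ ⊔ fvBounds Ns

var-apps-typable : ∀ x Ns → All UniformlyTypable Ns → UniformlyTypable (apps (var x) Ns)
var-apps-typable x Ns ts = (λ z → H ∩ spineRequirement Ns ts z) , tvar 0 , ⊢xNs
  where H = spineType Ns ts (tvar 0)
        ⊢xNs : ∀ Δ → (∀ {z} → z ∈FV apps (var x) Ns → Proj Δ z (H ∩ spineRequirement Ns ts z)) →
               Δ ⊢ℓ apps (var x) Ns ∶ tvar 0
        ⊢xNs Δ req = Proj-L∩ {Ns = Ns} (∩₁ (req (∈FV-apps-head Ns fv-var))) λ Δ' Δ⊆Δ' p →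
          ⊢ℓ-spine Ns ts p (Proj-mono Δ⊆Δ' ∘ ∩₂ ∘ req ∘ ∈FV-apps-arg (var x) Ns)

mutual
  WNe⇒var-apps : ∀ {M} → WNe M → ∃ λ x → ∃ λ Ns → M ≡ apps (var x) Ns × All UniformlyTypable Ns
  WNe⇒var-apps (var {x}) = x , [] , refl , []
  WNe⇒var-apps (app {N = N} m n) with WNe⇒var-apps m
  ... | x , Ns , refl , ts = x , Ns ++ N ∷ [] , sym (apps-∷ʳ (var x) Ns N) , ++⁺ ts (WN⇒uniformlyTypable n ∷ [])

  WN⇒uniformlyTypable : ∀ {M} → WN M → UniformlyTypable M
  WN⇒uniformlyTypable (ne m) with WNe⇒var-apps m
  ... | x , Ns , refl , ts = var-apps-typable x Ns ts
  WN⇒uniformlyTypable (lam {M} n) with WN⇒uniformlyTypable n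
  ... | R , A , ⊢M = R ∘ suc , R zero ⇒ A , λ Δ req → R→ (⊢M ((zero , R zero) ∷ shiftCtx Δ) (req' req))
    where req' : ∀ {Δ} → (∀ {x} → x ∈FV lam M → Proj Δ x (R (suc x))) →
                 ∀ {z} → z ∈FV M → Proj ((zero , R zero) ∷ shiftCtx Δ) z (R z)
          req' req {zero}  _ = elem (here refl)
          req' req {suc z} p = Proj-mono there (Proj-shift (req (fv-lam p)))
  WN⇒uniformlyTypable (exp h n) with WN⇒uniformlyTypable n | ⟶ₕ-inv h
  ... | R , A , ⊢M' | P , Q , Ns , refl , refl =
    R , A , λ Δ req → Beta-ℓ {M = P} {N = Q} {Ns = Ns} refl (⊢M' Δ (req ∘ ∈FV-[]-apps⁻ P Q Ns))

WN⇒⊢ℓ : ∀ {M} → WN M → ∃ λ (Γ : Ctx false) → ∃ λ A → Γ ⊢ℓ M ∶ A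
WN⇒⊢ℓ {M} w with WN⇒uniformlyTypable w
... | R , A , ⊢M = Γ , A , ⊢M Γ (λ p → elem (∈-map⁺ _ (∈-upTo⁺ (∈FV⇒<fvBound M p))))
  where Γ = map (λ x → x , R x) (upTo (fvBound M))

embTy : Ty false → Ty true
embTy (tvar φ) = tvar φ
embTy (A ⇒ B)  = embTy A ⇒ embTy B
embTy (A ∩ B)  = embTy A ∩ embTy B

embTy-ωFree : ∀ A → ωFree (embTy A)
embTy-ωFree (tvar φ) = tvar
embTy-ωFree (A ⇒ B)  = embTy-ωFree A ⇒ embTy-ωFree B
embTy-ωFree (A ∩ B)  = embTy-ωFree A ∩ embTy-ωFree B

embCtx : Ctx false → Ctx true
embCtx = map λ { (x , A) → x , embTy A }

embCtx-ωFree : ∀ Γ → ωFreeCtx (embCtx Γ)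
embCtx-ωFree Γ = map⁺ (All.tabulate λ { {x , A} _ → embTy-ωFree A })

embCtx-shift : ∀ Γ → embCtx (shiftCtx Γ) ≡ shiftCtx (embCtx Γ)
embCtx-shift []            = refl
embCtx-shift ((x , A) ∷ Γ) = cong ((suc x , embTy A) ∷_) (embCtx-shift Γ)

embCtx-⊆ : ∀ {Γ Δ} → Γ ⊆ Δ → embCtx Γ ⊆ embCtx Δ
embCtx-⊆ Γ⊆Δ p with ∈-map⁻ _ p
... | _ , q , refl = ∈-map⁺ _ (Γ⊆Δ q)

embCtx-≈ : ∀ {Γ Δ} → Γ ≈ctx Δ → embCtx Γ ≈ctx embCtx Δ
embCtx-≈ Γ≈Δ = mk⇔ (embCtx-⊆ (Equivalence.to Γ≈Δ)) (embCtx-⊆ (Equivalence.from Γ≈Δ))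

embSeq : ∀ {k} {Γ : Ctx false} {M A} → Seq k Γ M A → Seq k (embCtx Γ) M (embTy A)
embSeq (Ax p) = Ax (∈-map⁺ _ p)
embSeq (Beta-s {M = M} {N} {Ns} e d d') = Beta-s {M = M} {N = N} {Ns = Ns} e (embSeq d) (embSeq d')
embSeq (Beta-ℓ {M = M} {N} {Ns} e d)    = Beta-ℓ {M = M} {N = N} {Ns = Ns} e (embSeq d)
embSeq (L→ {Γ = Γ} {x = x} {y = y} {N = N} {Ns = Ns} Δ≈ y-fresh y∉Γ d d') =
  L→ {x = x} {y = y} {N = N} {Ns = Ns} (embCtx-≈ Δ≈) y-fresh y∉embΓ (embSeq d) (embSeq d')
  where y∉embΓ : y ∉ctx embCtx Γ
        y∉embΓ _ p with ∈-map⁻ _ p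
        ... | (_ , B) , q , refl = y∉Γ B q
embSeq {k} (R→ {Γ = Γ} {M} {A} {B} d) =
  R→ (substEq (λ Δ → Seq k ((zero , embTy A) ∷ Δ) M (embTy B)) (embCtx-shift Γ) (embSeq d))
embSeq (L∩ {x = x} {Ns = Ns} Δ≈ d) = L∩ {x = x} {Ns = Ns} (embCtx-≈ Δ≈) (embSeq d)
embSeq (R∩ d d') = R∩ (embSeq d) (embSeq d')

⊢ℓω⇒⊢sω : ∀ {Γ M A} → Γ ⊢ℓω M ∶ A → Γ ⊢sω M ∶ A
⊢ℓω⇒⊢sω (Ax p) = Ax p
⊢ℓω⇒⊢sω (Beta-s () d d')
⊢ℓω⇒⊢sω (Beta-ℓ {M = M} {N} {Ns} _ d) = Beta-s {M = M} {N = N} {Ns = Ns} refl (⊢ℓω⇒⊢sω d) ωAx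
⊢ℓω⇒⊢sω (L→ {x = x} {y = y} {N = N} {Ns = Ns} Δ≈ y-fresh y∉Γ d d') =
  L→ {x = x} {y = y} {N = N} {Ns = Ns} Δ≈ y-fresh y∉Γ (⊢ℓω⇒⊢sω d) (⊢ℓω⇒⊢sω d')
⊢ℓω⇒⊢sω (R→ d) = R→ (⊢ℓω⇒⊢sω d)
⊢ℓω⇒⊢sω (L∩ {x = x} {Ns = Ns} Δ≈ d) = L∩ {x = x} {Ns = Ns} Δ≈ (⊢ℓω⇒⊢sω d)
⊢ℓω⇒⊢sω (R∩ d d') = R∩ (⊢ℓω⇒⊢sω d) (⊢ℓω⇒⊢sω d')
⊢ℓω⇒⊢sω ωAx = ωAx

corollary3 : (M : Term) →
    ((∃ λ (Γ : Ctx true) → ∃ λ A → Functional Γ × ωFreeCtx Γ × ωFree A × Γ ⊢ω M ∶ A) ⇔ WeaklyNormalising M)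
    × ((∃ λ (Γ : Ctx true) → ∃ λ A → ωFreeCtx Γ × ωFree A × Γ ⊢sω M ∶ A) ⇔ WeaklyNormalising M)
    × ((∃ λ (Γ : Ctx true) → ∃ λ A → ωFreeCtx Γ × ωFree A × Γ ⊢ℓω M ∶ A) ⇔ WeaklyNormalising M)
    × ((∃ λ (Γ : Ctx false) → ∃ λ A → Γ ⊢ℓ M ∶ A) ⇔ WeaklyNormalising M)
corollary3 M =
  mk⇔ (λ (_ , _ , _ , Γ-free , A-free , d) → WN⇒weaklyNormalising (⊢ω⇒WN Γ-free A-free d))
      weaklyNormalising⇒⊢ω ,
  mk⇔ (λ (_ , _ , Γ-free , A-free , d) → WN⇒weaklyNormalising (Seq⇒WN d Γ-free A-free))
      (λ wn → let Γ , A , Γ-free , A-free , d = ⊢ℓω-of wn in Γ , A , Γ-free , A-free , ⊢ℓω⇒⊢sω d) ,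
  mk⇔ (λ (_ , _ , Γ-free , A-free , d) → WN⇒weaklyNormalising (Seq⇒WN d Γ-free A-free))
      ⊢ℓω-of ,
  mk⇔ (λ (Γ , A , d) → WN⇒weaklyNormalising (Seq⇒WN (embSeq d) (embCtx-ωFree Γ) (embTy-ωFree A)))
      (WN⇒⊢ℓ ∘ weaklyNormalising⇒WN)
  where
    ⊢ℓω-of : WeaklyNormalising M → ∃ λ (Γ : Ctx true) → ∃ λ A → ωFreeCtx Γ × ωFree A × Γ ⊢ℓω M ∶ A
    ⊢ℓω-of wn with WN⇒⊢ℓ (weaklyNormalising⇒WN wn)
    ... | Γ , A , d = embCtx Γ , embTy A , embCtx-ωFree Γ , embTy-ωFree A , embSeq d
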